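{- If $\mathcal{G}$ is a hereditary family of graphs, then $\mathcal{G}$ has the Erdős–Hajnal property if and only if it has the quasi-Erdős–Hajnal property.
   Context: A family of graphs is hereditary if it is closed under taking induced subgraphs. A family $\mathcal{G}$ has the Erdős–Hajnal property if there is a constant $c>0$ such that every $G\in\mathcal{G}$ contains a clique or an independent set of size at least $|V(G)|^{c}$. A family $\mathcal{G}$ has the quasi-Erdős–Hajnal property if there is a constant $c>0$ such that for every $G\in\mathcal{G}$ with at least 2 vertices there exist an integer $t\geq 2$ and $t$ pairwise disjoint subsets $X_1,\dots,X_t$ of $V(G)$ with $t\geq \left(\frac{|V(G)|}{|X_i|}\right)^{c}$ for $i=1,\dots,t$, such that either $X_i$ is complete to $X_j$ (every vertex of $X_i$ adjacent to every vertex of $X_j$) for all $1\leq i<j\leq t$, or there is no edge between $X_i$ and $X_j$ for all $1\leq i<j\leq t$.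
   Formalization: The constant $c>0$ in the Erdős–Hajnal and quasi-Erdős–Hajnal properties is taken in the positive rationals. -}

module Defs where

open import Data.Nat using (ℕ; _≤_; _*_; _^_)
open import Data.Bool using (Bool; true; false)
open import Data.Fin using (Fin)
open import Data.Fin.Subset using (Subset; _∈_; ∣_∣)
open import Data.Product using (Σ; _×_; _,_; ∃)
open import Data.Sum using (_⊎_)
open import Data.Empty using (⊥)
open import Relation.Nullary using (¬_)
open import Relation.Binary.PropositionalEquality using (_≡_; _≢_)
open import Function.Definitions using (Injective)

record Graph : Set where
  field
    n     : ℕ
    adj   : Fin n → Fin n → Bool
    sym   : ∀ u v → adj u v ≡ adj v u
    irrefl : ∀ u → adj u u ≡ false
open Graph public

Family : Set₁
Family = Graph → Set

_≼_ : Graph → Graph → Set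
H ≼ G = Σ (Fin (n H) → Fin (n G)) λ f →
          Injective _≡_ _≡_ f × (∀ u v → adj G (f u) (f v) ≡ adj H u v)

Hereditary : Family → Set
Hereditary 𝒢 = ∀ G H → 𝒢 G → H ≼ G → 𝒢 H

IsClique : (G : Graph) → Subset (n G) → Set
IsClique G S = ∀ u v → u ∈ S → v ∈ S → u ≢ v → adj G u v ≡ true

IsIndependent : (G : Graph) → Subset (n G) → Set
IsIndependent G S = ∀ u v → u ∈ S → v ∈ S → u ≢ v → adj G u v ≡ false

-- Erdős–Hajnal property with exponent c = p / q (p, q ≥ 1):
-- a clique or independent set S with |S| ≥ |V(G)|^(p/q), i.e. |V|^p ≤ |S|^q.
EHWith : ℕ → ℕ → Family → Set
EHWith p q 𝒢 = ∀ G → 𝒢 G → Σ (Subset (n G)) λ S →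
  (IsClique G S ⊎ IsIndependent G S) × (n G ^ p ≤ ∣ S ∣ ^ q)

ErdosHajnal : Family → Set
ErdosHajnal 𝒢 = Σ ℕ λ p → Σ ℕ λ q → 1 ≤ p × 1 ≤ q × EHWith p q 𝒢

Disjoint : ∀ {m} → Subset m → Subset m → Set
Disjoint A B = ∀ v → v ∈ A → v ∈ B → ⊥

Complete : (G : Graph) → Subset (n G) → Subset (n G) → Set
Complete G A B = ∀ u v → u ∈ A → v ∈ B → adj G u v ≡ true

Anticomplete : (G : Graph) → Subset (n G) → Subset (n G) → Set
Anticomplete G A B = ∀ u v → u ∈ A → v ∈ B → adj G u v ≡ false

-- Quasi-Erdős–Hajnal property with exponent c = p / q:
-- t ≥ (|V|/|X_i|)^(p/q)  ⇔  |V|^p ≤ t^q · |X_i|^p.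
QEHWith : ℕ → ℕ → Family → Set
QEHWith p q 𝒢 = ∀ G → 𝒢 G → 2 ≤ n G →
  Σ ℕ λ t → Σ (Fin t → Subset (n G)) λ X →
    2 ≤ t
    × (∀ i j → i ≢ j → Disjoint (X i) (X j))
    × (∀ i → n G ^ p ≤ t ^ q * ∣ X i ∣ ^ p)
    × ((∀ i j → i ≢ j → Complete G (X i) (X j))
       ⊎ (∀ i j → i ≢ j → Anticomplete G (X i) (X j)))

QuasiErdosHajnal : Family → Set
QuasiErdosHajnal 𝒢 = Σ ℕ λ p → Σ ℕ λ q → 1 ≤ p × 1 ≤ q × QEHWith p q 𝒢

-- EH ⇒ QEH: the singletons of a homogeneous set S form a complete or
-- anticomplete family of |S| parts of size one.
--
-- QEH ⇒ EH (exponent p/q becomes p/2q): by induction on |V(G)|, every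
-- G ∈ 𝒢 contains a clique A and an independent set B with
-- |V(G)|^p ≤ (|A|·|B|)^q.  If X₁ … X_t is, say, a complete family given by
-- QEH, induction in the smaller hereditary members G[X_i] yields A_i, B_i;
-- the union of the A_i is again a clique, and with B the largest B_i,
--   |A|·|B| ≥ Σ |A_i|·|B_i| ≥ t · min_i |A_i|·|B_i|,
-- while t^q · |A_i|^q·|B_i|^q ≥ t^q · |X_i|^p ≥ |V(G)|^p.  The anticomplete
-- case is the same with cliques and independent sets exchanged.  Finally
-- |A|·|B| ≤ max(|A|, |B|)².

module Submission where

open import Defs
open import Data.Bool using (Bool; true; false; not)
open import Data.Empty using (⊥-elim)
open import Data.Fin using (Fin; zero; suc; fromℕ<)
open import Data.Fin.Properties using (suc-injective)
open import Data.Fin.Subset using (Subset; _∈_; ∣_∣; inside; outside; ⁅_⁆; _∪_; _⊂_; ∁)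
import Data.Fin.Subset as Subset
open import Data.Fin.Subset.Properties
  using (∉⊥; x∈⁅x⁆; x∈⁅y⁆⇒x≡y; ∣⁅x⁆∣≡1; x∈p∪q⁺; x∈p∪q⁻; q⊆p∪q; x∉p⇒x∈∁p; ∣∁p∣≡n∸∣p∣;
         ∣p∣≤n; p⊆q⇒∣p∣≤∣q∣; p⊂q⇒∣p∣<∣q∣)
open import Data.List using (List; []; _∷_; map; foldr; length; concat; tabulate; allFin)
open import Data.List.Relation.Unary.Unique.Propositional using (Unique)
open import Data.List.Properties using (length-map; length-++)
open import Data.List.Extrema.Nat using (argmin; argmax; f[argmin]≤f[xs]; f[xs]≤f[argmax])
open import Data.List.Membership.Propositional using () renaming (_∈_ to _∈ₗ_)
open import Data.List.Membership.Propositional.Properties using (∈-allFin)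
open import Data.List.Relation.Unary.All as All using (All; []; _∷_)
import Data.List.Relation.Unary.All.Properties as All
open import Data.List.Relation.Unary.AllPairs as AllPairs using (AllPairs; []; _∷_)
import Data.List.Relation.Unary.AllPairs.Properties as AllPairs
open import Data.List.Relation.Unary.Any using (here; there)
open import Data.Nat using (ℕ; zero; suc; _+_; _*_; _^_; _∸_; _≤_; _<_; z≤n; s≤s; _≤?_)
open import Data.Nat.Induction using (<-wellFounded)
import Data.Nat.Properties as ℕ
open import Data.Product using (Σ; ∃-syntax; _×_; _,_; proj₁; proj₂)
open import Data.Sum as Sum using (_⊎_; inj₁; inj₂)
open import Data.Vec using (_∷_; here; there)
open import Data.Vec.Functional using (Vector)
open import Function using (_∘_)
open import Function.Definitions using (Injective)
import Induction.WellFounded as WF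
import Relation.Binary.Construct.On as On
open import Relation.Binary.PropositionalEquality as ≡ using (_≡_; _≢_; refl; trans; cong; cong₂)
open import Relation.Nullary using (yes; no)
open import Algebra.Properties.Semiring.Sum ℕ.+-*-semiring using (sum; *-distribʳ-sum)

open ℕ.≤-Reasoning

^-distribʳ-* : ∀ m n k → (m * n) ^ k ≡ m ^ k * n ^ k
^-distribʳ-* m n zero    = refl
^-distribʳ-* m n (suc k) = trans (cong (m * n *_) (^-distribʳ-* m n k))
  (ℕ.[m*n]*[o*p]≡[m*o]*[n*p] m n (m ^ k) (n ^ k))

[m*n]^k≤o^[2*k] : ∀ {m n o} k → m ≤ o → n ≤ o → (m * n) ^ k ≤ o ^ (2 * k)
[m*n]^k≤o^[2*k] {m} {n} {o} k m≤o n≤o = begin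
  (m * n) ^ k   ≤⟨ ℕ.^-monoˡ-≤ k (ℕ.*-mono-≤ m≤o n≤o) ⟩
  (o * o) ^ k   ≡⟨ cong (λ x → (o * x) ^ k) (≡.sym (ℕ.*-identityʳ o)) ⟩
  (o ^ 2) ^ k   ≡⟨ ℕ.^-*-assoc o 2 k ⟩
  o ^ (2 * k)   ∎

sum-mono-≤ : ∀ {t} {f g : Vector ℕ t} → (∀ i → f i ≤ g i) → sum f ≤ sum g
sum-mono-≤ {zero}  f≤g = z≤n
sum-mono-≤ {suc t} f≤g = ℕ.+-mono-≤ (f≤g zero) (sum-mono-≤ (f≤g ∘ suc))

*≤sum : ∀ {t m} (f : Vector ℕ t) → (∀ i → m ≤ f i) → t * m ≤ sum f
*≤sum {zero}  f m≤f = z≤n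
*≤sum {suc t} f m≤f = ℕ.+-mono-≤ (m≤f zero) (*≤sum (f ∘ suc) (m≤f ∘ suc))

∃-minimiser : ∀ {t} (f : Fin (suc t) → ℕ) → ∃[ k ] (∀ i → f k ≤ f i)
∃-minimiser f = argmin f zero (allFin _) ,
  λ i → All.lookup (f[argmin]≤f[xs] {f = f} zero (allFin _)) (∈-allFin i)

∃-maximiser : ∀ {t} (f : Fin (suc t) → ℕ) → ∃[ k ] (∀ i → f i ≤ f k)
∃-maximiser f = argmax f zero (allFin _) ,
  λ i → All.lookup (f[xs]≤f[argmax] {f = f} zero (allFin _)) (∈-allFin i)

length-concat-tabulate : ∀ {A : Set} {t} (xss : Fin t → List A) →
  length (concat (tabulate xss)) ≡ sum (length ∘ xss)
length-concat-tabulate {t = zero}  xss = refl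
length-concat-tabulate {t = suc t} xss = trans (length-++ (xss zero))
  (cong (length (xss zero) +_) (length-concat-tabulate (xss ∘ suc)))

0^n≡0 : ∀ {n} → 1 ≤ n → 0 ^ n ≡ 0
0^n≡0 (s≤s z≤n) = refl

m^p≤c*x^p⇒0<x : ∀ {m x p} c → 0 < m → 0 < p → m ^ p ≤ c * x ^ p → 0 < x
m^p≤c*x^p⇒0<x {x = suc x} _ _ _ _ = s≤s z≤n
m^p≤c*x^p⇒0<x {suc m} {zero} {suc p} c _ _ m^p≤0 =
  ⊥-elim (ℕ.<⇒≱ (ℕ.m^n>0 (suc m) (suc p)) (ℕ.≤-trans m^p≤0 (ℕ.≤-reflexive (ℕ.*-zeroʳ c))))

m^p≤t^q⇒2≤t : ∀ {m p q t} → 2 ≤ m → 1 ≤ p → m ^ p ≤ t ^ q → 2 ≤ t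
m^p≤t^q⇒2≤t {m} {suc p} {q} {t} 2≤m _ m^p≤t^q with 2 ≤? t
... | yes 2≤t = 2≤t
... | no  2≰t = ⊥-elim (ℕ.<⇒≱ 1<m^p (ℕ.≤-trans m^p≤t^q t^q≤1))
  where
  1<m^p : 1 < m ^ suc p
  1<m^p = ℕ.≤-trans (ℕ.≤-reflexive (cong suc (≡.sym (ℕ.^-zeroˡ (suc p))))) (ℕ.^-monoˡ-< (suc p) 2≤m)
  t^q≤1 : t ^ q ≤ 1
  t^q≤1 = ℕ.≤-trans (ℕ.^-monoˡ-≤ q (ℕ.≤-pred (ℕ.≰⇒> 2≰t))) (ℕ.≤-reflexive (ℕ.^-zeroˡ q))

enum : ∀ {m} (S : Subset m) → Fin ∣ S ∣ → Fin m
enum (inside  ∷ S) zero    = zero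
enum (inside  ∷ S) (suc i) = suc (enum S i)
enum (outside ∷ S) i       = suc (enum S i)

enum-∈ : ∀ {m} (S : Subset m) i → enum S i ∈ S
enum-∈ (inside  ∷ S) zero    = here
enum-∈ (inside  ∷ S) (suc i) = there (enum-∈ S i)
enum-∈ (outside ∷ S) i       = there (enum-∈ S i)

enum-injective : ∀ {m} (S : Subset m) → Injective _≡_ _≡_ (enum S)
enum-injective (inside  ∷ S) {zero}  {zero}  _  = refl
enum-injective (inside  ∷ S) {suc i} {suc j} eq = cong suc (enum-injective S (suc-injective eq))
enum-injective (outside ∷ S)                 eq = enum-injective S (suc-injective eq)

induced : (G : Graph) → Subset (n G) → Graph
induced G S = record
  { n      = ∣ S ∣
  ; adj    = λ u v → adj G (enum S u) (enum S v)
  ; sym    = λ u v → sym G (enum S u) (enum S v)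
  ; irrefl = λ u → irrefl G (enum S u)
  }

induced-≼ : ∀ G S → induced G S ≼ G
induced-≼ G S = enum S , enum-injective S , λ _ _ → refl

disjoint⇒∣p∣<n : ∀ {m} {p q : Subset m} → Disjoint p q → 0 < ∣ q ∣ → ∣ p ∣ < m
disjoint⇒∣p∣<n {m} {p} {q} p#q 0<∣q∣ = begin-strict
  ∣ p ∣      ≤⟨ p⊆q⇒∣p∣≤∣q∣ (λ u∈p → x∉p⇒x∈∁p (p#q _ u∈p)) ⟩
  ∣ ∁ q ∣    ≡⟨ ∣∁p∣≡n∸∣p∣ q ⟩
  m ∸ ∣ q ∣  <⟨ ℕ.∸-monoʳ-< 0<∣q∣ (∣p∣≤n q) ⟩
  m          ∎

Joined : (G : Graph) → Bool → Fin (n G) → Fin (n G) → Set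
Joined G b u v = u ≢ v × adj G u v ≡ b

Homogeneous : (G : Graph) → Bool → List (Fin (n G)) → Set
Homogeneous G b = AllPairs (Joined G b)

homogeneous-adj : ∀ {G b xs u v} → Homogeneous G b xs → u ∈ₗ xs → v ∈ₗ xs → u ≢ v → adj G u v ≡ b
homogeneous-adj     (_ ∷ _)  (here refl) (here refl) u≢v = ⊥-elim (u≢v refl)
homogeneous-adj     (h ∷ _)  (here refl) (there v∈) _    = proj₂ (All.lookup h v∈)
homogeneous-adj {G} (h ∷ _)  (there u∈)  (here refl) _   = trans (sym G _ _) (proj₂ (All.lookup h u∈))
homogeneous-adj {G} (_ ∷ hs) (there u∈)  (there v∈) u≢v  = homogeneous-adj {G} hs u∈ v∈ u≢v

homogeneous-enum : ∀ {b} G (S : Subset (n G)) {xs} →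
  Homogeneous (induced G S) b xs → Homogeneous G b (map (enum S) xs)
homogeneous-enum G S = AllPairs.map⁺ ∘ AllPairs.map (λ (u≢v , uv) → u≢v ∘ enum-injective S , uv)

map-enum-⊆ : ∀ {m} (S : Subset m) xs → All (_∈ S) (map (enum S) xs)
map-enum-⊆ S xs = All.map⁺ (All.universal (enum-∈ S) xs)

fromList : ∀ {m} → List (Fin m) → Subset m
fromList = foldr (λ x S → ⁅ x ⁆ ∪ S) Subset.⊥

∈-fromList⁻ : ∀ {m} (xs : List (Fin m)) {u} → u ∈ fromList xs → u ∈ₗ xs
∈-fromList⁻ []       u∈ = ⊥-elim (∉⊥ u∈)
∈-fromList⁻ (x ∷ xs) u∈ with x∈p∪q⁻ ⁅ x ⁆ (fromList xs) u∈
... | inj₁ u∈⁅x⁆ = here (x∈⁅y⁆⇒x≡y x u∈⁅x⁆)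
... | inj₂ u∈xs  = there (∈-fromList⁻ xs u∈xs)

length≤∣fromList∣ : ∀ {m} {xs : List (Fin m)} → Unique xs → length xs ≤ ∣ fromList xs ∣
length≤∣fromList∣ []                 = z≤n
length≤∣fromList∣ {xs = x ∷ xs} (x∉xs ∷ xs!) =
  ℕ.≤-trans (s≤s (length≤∣fromList∣ xs!)) (p⊂q⇒∣p∣<∣q∣ fromList-⊂)
  where
  fromList-⊂ : fromList xs ⊂ fromList (x ∷ xs)
  fromList-⊂ = q⊆p∪q ⁅ x ⁆ (fromList xs) , x , x∈p∪q⁺ (inj₁ (x∈⁅x⁆ x)) ,
               λ x∈xs → All.lookup x∉xs (∈-fromList⁻ xs x∈xs) refl

homogeneous⇒subset : ∀ {G b xs} → Homogeneous G b xs → Σ (Subset (n G)) λ S →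
  (∀ u v → u ∈ S → v ∈ S → u ≢ v → adj G u v ≡ b) × length xs ≤ ∣ S ∣
homogeneous⇒subset {G} {xs = xs} h = fromList xs ,
  (λ u v u∈ v∈ → homogeneous-adj {G} h (∈-fromList⁻ xs u∈) (∈-fromList⁻ xs v∈)) ,
  length≤∣fromList∣ (AllPairs.map proj₁ h)

record HomogeneousPair (G : Graph) (b : Bool) : Set where
  field
    xs ys          : List (Fin (n G))
    xs-homogeneous : Homogeneous G b xs
    ys-homogeneous : Homogeneous G (not b) ys

  size : ℕ
  size = length xs * length ys

open HomogeneousPair

-- The clauses coincide, but matching on b is needed for not (not b) to reduce to b.
swap : ∀ {G b} → HomogeneousPair G b → HomogeneousPair G (not b)
swap {b = true}  P = record
  { xs = ys P ; ys = xs P ; xs-homogeneous = ys-homogeneous P ; ys-homogeneous = xs-homogeneous P }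
swap {b = false} P = record
  { xs = ys P ; ys = xs P ; xs-homogeneous = ys-homogeneous P ; ys-homogeneous = xs-homogeneous P }

size-swap : ∀ {G b} (P : HomogeneousPair G b) → size (swap P) ≡ size P
size-swap {b = true}  P = ℕ.*-comm (length (ys P)) (length (xs P))
size-swap {b = false} P = ℕ.*-comm (length (ys P)) (length (xs P))

lift : ∀ {b} G (S : Subset (n G)) → HomogeneousPair (induced G S) b → HomogeneousPair G b
lift G S P = record
  { xs             = map (enum S) (xs P)
  ; ys             = map (enum S) (ys P)
  ; xs-homogeneous = homogeneous-enum G S (xs-homogeneous P)
  ; ys-homogeneous = homogeneous-enum G S (ys-homogeneous P)
  }

size-lift : ∀ {b} G (S : Subset (n G)) (P : HomogeneousPair (induced G S) b) →
  size (lift G S P) ≡ size P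
size-lift G S P = cong₂ _*_ (length-map (enum S) (xs P)) (length-map (enum S) (ys P))

glue : ∀ {G b t m} (X : Fin (suc t) → Subset (n G)) →
  (∀ i j → i ≢ j → Disjoint (X i) (X j)) →
  (∀ i j → i ≢ j → ∀ u v → u ∈ X i → v ∈ X j → adj G u v ≡ b) →
  (P : ∀ i → HomogeneousPair (induced G (X i)) b) → (∀ i → m ≤ size (P i)) →
  Σ (HomogeneousPair G b) λ Q → suc t * m ≤ size Q
glue {G} {b} {t} {m} X disjoint uniform P m≤P = Q , suc[t]*m≤size[Q]
  where
  P′ : Fin (suc t) → HomogeneousPair G b
  P′ i = lift G (X i) (P i)

  j : Fin (suc t)
  j = proj₁ (∃-maximiser (length ∘ ys ∘ P′))

  ys-max : ∀ i → length (ys (P′ i)) ≤ length (ys (P′ j))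
  ys-max = proj₂ (∃-maximiser (length ∘ ys ∘ P′))

  joined : ∀ {i k} → i ≢ k → All (λ u → All (Joined G b u) (xs (P′ k))) (xs (P′ i))
  joined {i} {k} i≢k = All.map
    (λ u∈ → All.map (λ v∈ → (λ { refl → disjoint i k i≢k _ u∈ v∈ }) , uniform i k i≢k _ _ u∈ v∈)
                    (map-enum-⊆ (X k) (xs (P k))))
    (map-enum-⊆ (X i) (xs (P i)))

  Q : HomogeneousPair G b
  Q = record
    { xs             = concat (tabulate (xs ∘ P′))
    ; ys             = ys (P′ j)
    ; xs-homogeneous = AllPairs.concat⁺ (All.tabulate⁺ (xs-homogeneous ∘ P′)) (AllPairs.tabulate⁺ joined)
    ; ys-homogeneous = ys-homogeneous (P′ j)
    }

  suc[t]*m≤size[Q] : suc t * m ≤ size Q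
  suc[t]*m≤size[Q] = begin
    suc t * m
      ≤⟨ *≤sum (size ∘ P′) (λ i → ℕ.≤-trans (m≤P i) (ℕ.≤-reflexive (≡.sym (size-lift G (X i) (P i))))) ⟩
    sum (size ∘ P′)
      ≤⟨ sum-mono-≤ (λ i → ℕ.*-monoʳ-≤ (length (xs (P′ i))) (ys-max i)) ⟩
    sum (λ i → length (xs (P′ i)) * length (ys (P′ j)))
      ≡⟨ ≡.sym (*-distribʳ-sum (length (ys (P′ j))) (length ∘ xs ∘ P′)) ⟩
    sum (length ∘ xs ∘ P′) * length (ys (P′ j))
      ≡⟨ cong (_* length (ys (P′ j))) (≡.sym (length-concat-tabulate (xs ∘ P′))) ⟩
    size Q ∎

∃-other : ∀ {t} (i : Fin (suc (suc t))) → ∃[ j ] i ≢ j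
∃-other zero    = suc zero , λ ()
∃-other (suc i) = zero , λ ()

module _ (𝒢 : Family) (hereditary : Hereditary 𝒢) {p q : ℕ} (1≤p : 1 ≤ p) (qeh : QEHWith p q 𝒢) where

  LargePair : Graph → Set
  LargePair G = Σ (HomogeneousPair G true) λ P → n G ^ p ≤ size P ^ q

  largePair-small : ∀ G → n G ≤ 1 → LargePair G
  largePair-small G n≤1 with 1 ≤? n G
  ... | yes 1≤n = record { xs = v ∷ [] ; ys = v ∷ [] ; xs-homogeneous = [] ∷ [] ; ys-homogeneous = [] ∷ [] } ,
    (begin
      n G ^ p  ≤⟨ ℕ.^-monoˡ-≤ p n≤1 ⟩
      1 ^ p    ≡⟨ ℕ.^-zeroˡ p ⟩
      1        ≡⟨ ≡.sym (ℕ.^-zeroˡ q) ⟩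
      1 ^ q    ∎)
    where v = fromℕ< 1≤n
  ... | no 1≰n = record { xs = [] ; ys = [] ; xs-homogeneous = [] ; ys-homogeneous = [] } ,
    (begin
      n G ^ p  ≤⟨ ℕ.^-monoˡ-≤ p (ℕ.≤-pred (ℕ.≰⇒> 1≰n)) ⟩
      0 ^ p    ≡⟨ 0^n≡0 1≤p ⟩
      0        ≤⟨ z≤n ⟩
      0 ^ q    ∎)

  largePair-step : ∀ G → 𝒢 G → 2 ≤ n G → (∀ {H} → n H < n G → 𝒢 H → LargePair H) → LargePair G
  largePair-step G G∈𝒢 2≤n largePair< with qeh G G∈𝒢 2≤n
  ... | suc (suc t) , X , s≤s (s≤s _) , disjoint , X-large , uniform = glue-parts uniform
    where
    part-smaller : ∀ i → ∣ X i ∣ < n G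
    part-smaller i = disjoint⇒∣p∣<n (disjoint i j i≢j)
      (m^p≤c*x^p⇒0<x (suc (suc t) ^ q) (ℕ.≤-trans (s≤s z≤n) 2≤n) 1≤p (X-large j))
      where j = proj₁ (∃-other i) ; i≢j = proj₂ (∃-other i)

    part : ∀ i → LargePair (induced G (X i))
    part i = largePair< (part-smaller i) (hereditary G _ G∈𝒢 (induced-≼ G (X i)))

    P : ∀ i → HomogeneousPair (induced G (X i)) true
    P = proj₁ ∘ part

    k : Fin (suc (suc t))
    k = proj₁ (∃-minimiser (size ∘ P))

    P-min : ∀ i → size (P k) ≤ size (P i)
    P-min = proj₂ (∃-minimiser (size ∘ P))

    large : ∀ (Q : HomogeneousPair G true) → suc (suc t) * size (P k) ≤ size Q → n G ^ p ≤ size Q ^ q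
    large Q t*P≤Q = begin
      n G ^ p                                 ≤⟨ X-large k ⟩
      suc (suc t) ^ q * ∣ X k ∣ ^ p           ≤⟨ ℕ.*-monoʳ-≤ (suc (suc t) ^ q) (proj₂ (part k)) ⟩
      suc (suc t) ^ q * size (P k) ^ q        ≡⟨ ≡.sym (^-distribʳ-* (suc (suc t)) (size (P k)) q) ⟩
      (suc (suc t) * size (P k)) ^ q          ≤⟨ ℕ.^-monoˡ-≤ q t*P≤Q ⟩
      size Q ^ q                              ∎

    glue-parts : (∀ i j → i ≢ j → Complete G (X i) (X j))
               ⊎ (∀ i j → i ≢ j → Anticomplete G (X i) (X j)) → LargePair G
    glue-parts (inj₁ complete) =
      let Q , t*P≤Q = glue X disjoint complete P P-min in Q , large Q t*P≤Q
    glue-parts (inj₂ anticomplete) =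
      let Q , t*P≤Q = glue X disjoint anticomplete (swap ∘ P)
                        (λ i → ℕ.≤-trans (P-min i) (ℕ.≤-reflexive (≡.sym (size-swap (P i)))))
      in swap Q , large (swap Q) (ℕ.≤-trans t*P≤Q (ℕ.≤-reflexive (≡.sym (size-swap Q))))

  largePair : ∀ G → 𝒢 G → LargePair G
  largePair = WF.All.wfRec (On.wellFounded n <-wellFounded) _ (λ G → 𝒢 G → LargePair G) step
    where
    step : ∀ G → (∀ {H} → n H < n G → 𝒢 H → LargePair H) → 𝒢 G → LargePair G
    step G largePair< G∈𝒢 with 2 ≤? n G
    ... | yes 2≤n = largePair-step G G∈𝒢 2≤n largePair<
    ... | no  2≰n = largePair-small G (ℕ.≤-pred (ℕ.≰⇒> 2≰n))

  erdosHajnalWith : EHWith p (2 * q) 𝒢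
  erdosHajnalWith G G∈𝒢 with largePair G G∈𝒢
  ... | P , large with ℕ.≤-total (length (xs P)) (length (ys P))
  ... | inj₁ xs≤ys =
    let S , independent , ys≤S = homogeneous⇒subset {G} (ys-homogeneous P)
    in S , inj₂ independent , ℕ.≤-trans large ([m*n]^k≤o^[2*k] q (ℕ.≤-trans xs≤ys ys≤S) ys≤S)
  ... | inj₂ ys≤xs =
    let S , clique , xs≤S = homogeneous⇒subset {G} (xs-homogeneous P)
    in S , inj₁ clique , ℕ.≤-trans large ([m*n]^k≤o^[2*k] q xs≤S (ℕ.≤-trans ys≤xs xs≤S))

quasiErdosHajnal⇒erdosHajnal : ∀ 𝒢 → Hereditary 𝒢 → QuasiErdosHajnal 𝒢 → ErdosHajnal 𝒢
quasiErdosHajnal⇒erdosHajnal 𝒢 hereditary (p , q , 1≤p , 1≤q , qeh) =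
  p , 2 * q , 1≤p , ℕ.≤-trans 1≤q (ℕ.m≤m+n q (q + 0)) , erdosHajnalWith 𝒢 hereditary {q = q} 1≤p qeh

singletons : ∀ {m} (S : Subset m) → Fin ∣ S ∣ → Subset m
singletons S i = ⁅ enum S i ⁆

singletons-disjoint : ∀ {m} (S : Subset m) i j → i ≢ j → Disjoint (singletons S i) (singletons S j)
singletons-disjoint S i j i≢j v v∈i v∈j =
  i≢j (enum-injective S (trans (≡.sym (x∈⁅y⁆⇒x≡y _ v∈i)) (x∈⁅y⁆⇒x≡y _ v∈j)))

singletons-uniform : ∀ {G b} (S : Subset (n G)) → (∀ u v → u ∈ S → v ∈ S → u ≢ v → adj G u v ≡ b) →
  ∀ i j → i ≢ j → ∀ u v → u ∈ singletons S i → v ∈ singletons S j → adj G u v ≡ b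
singletons-uniform S uniform i j i≢j u v u∈ v∈
  rewrite x∈⁅y⁆⇒x≡y _ u∈ | x∈⁅y⁆⇒x≡y _ v∈ =
  uniform _ _ (enum-∈ S i) (enum-∈ S j) (i≢j ∘ enum-injective S)

∣singletons∣^p≡1 : ∀ {m} (S : Subset m) i p → ∣ singletons S i ∣ ^ p ≡ 1
∣singletons∣^p≡1 S i p = trans (cong (_^ p) (∣⁅x⁆∣≡1 (enum S i))) (ℕ.^-zeroˡ p)

erdosHajnal⇒quasiErdosHajnal : ∀ 𝒢 → ErdosHajnal 𝒢 → QuasiErdosHajnal 𝒢
erdosHajnal⇒quasiErdosHajnal 𝒢 (p , q , 1≤p , 1≤q , eh) = p , q , 1≤p , 1≤q , quasiErdosHajnalWith
  where
  quasiErdosHajnalWith : QEHWith p q 𝒢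
  quasiErdosHajnalWith G G∈𝒢 2≤n =
    let S , homogeneous , large = eh G G∈𝒢
    in ∣ S ∣ , singletons S , m^p≤t^q⇒2≤t {q = q} 2≤n 1≤p large , singletons-disjoint S ,
       (λ i → begin
          n G ^ p                            ≤⟨ large ⟩
          ∣ S ∣ ^ q                          ≡⟨ ≡.sym (ℕ.*-identityʳ _) ⟩
          ∣ S ∣ ^ q * 1                      ≡⟨ cong (∣ S ∣ ^ q *_) (≡.sym (∣singletons∣^p≡1 S i p)) ⟩
          ∣ S ∣ ^ q * ∣ singletons S i ∣ ^ p ∎) ,
       Sum.map (singletons-uniform {G} S) (singletons-uniform {G} S) homogeneous

lemma8 : (𝒢 : Family) → Hereditary 𝒢 →
    (ErdosHajnal 𝒢 → QuasiErdosHajnal 𝒢) × (QuasiErdosHajnal 𝒢 → ErdosHajnal 𝒢)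
lemma8 𝒢 hereditary = erdosHajnal⇒quasiErdosHajnal 𝒢 , quasiErdosHajnal⇒erdosHajnal 𝒢 hereditary
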